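{- Let $T$ be a binary tree (every vertex has degree $1$ or $3$), $L$ a set of links each joining two leaves of $T$, and $x$ a feasible solution to the NODE-LP. Let $e=uv$ be a deficient tree edge where $u$ is an internal vertex with neighbours $v,w_1,w_2$. Then \[ x\big((\delta(uw_1)\cup\delta(uw_2))\setminus\delta(uv)\big)\ge \tfrac23, \] i.e. the total weight of links passing through $u$ but not covering $e$ is at least $2/3$.
   Context: A link $\ell$ covers a tree edge $f$ if $f$ lies on the unique path in $T$ between the endpoints of $\ell$; $\delta(f)$ is the set of links covering $f$, $x(F)=\sum_{\ell\in F}x_\ell$. The NODE-LP consists of $x(\delta(f))\ge1$ for every tree edge $f$, $x(\delta(e_1)\cup\delta(e_2)\cup\delta(e_3))\ge 2$ for every vertex of degree $3$ with incident tree edges $e_1,e_2,e_3$, and $x\ge0$. A tree edge $f$ is deficient if $x(\delta(f))<4/3$.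
   Formalization: The feasible solution x to the NODE-LP takes values in the rationals. -}

module Defs where

open import Data.Nat using (ℕ; zero; suc) renaming (_≤_ to _≤ℕ_)
open import Data.Fin using (Fin)
open import Data.Bool using (Bool; true; false; T; if_then_else_)
open import Data.List using (List; []; _∷_; length; map; foldr; allFin)
open import Data.List.Relation.Unary.Unique.Propositional using (Unique)
open import Data.Product using (Σ; ∃; _×_; _,_; proj₁; proj₂)
open import Data.Sum using (_⊎_)
open import Relation.Nullary using (¬_; Dec; does)
open import Relation.Nullary.Decidable using (_⊎-dec_; _×-dec_; ¬?)
open import Relation.Binary.PropositionalEquality using (_≡_)
import Data.Integer
import Data.Nat
import Data.Rational as ℚ
open ℚ using (ℚ; 0ℚ)

-- A (simple, undirected) graph on vertex set Fin n is given by a Bool-valued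
-- adjacency function E; its properties (symmetry, irreflexivity) are in IsTree.
Graph : ℕ → Set
Graph n = Fin n → Fin n → Bool

module _ {n : ℕ} (E : Graph n) where

  data Walk : Fin n → Fin n → List (Fin n) → Set where
    single : ∀ u → Walk u u (u ∷ [])
    step   : ∀ {u w v p} → T (E u w) → Walk w v p → Walk u v (u ∷ p)

  IsPath : Fin n → Fin n → List (Fin n) → Set
  IsPath u v p = Walk u v p × Unique p

  degree : Fin n → ℕ
  degree u = foldr Data.Nat._+_ 0 (map (λ v → if E u v then 1 else 0) (allFin n))

  IsLeaf : Fin n → Set
  IsLeaf u = degree u ≡ 1

  record IsTree : Set where
    field
      symmetric   : ∀ u v → E u v ≡ E v u
      irreflexive : ∀ u → E u u ≡ false
      connected   : ∀ u v → ∃ λ p → Walk u v p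
      -- no cycle: no path v₀ … vₖ with k ≥ 2 whose ends are adjacent
      acyclic     : ∀ u v p → IsPath u v p → 3 ≤ℕ length p → ¬ T (E v u)

  IsBinary : Set
  IsBinary = ∀ u → degree u ≡ 1 ⊎ degree u ≡ 3

data Consec {n : ℕ} (a b : Fin n) : List (Fin n) → Set where
  here  : ∀ rest → Consec a b (a ∷ b ∷ rest)
  there : ∀ c {rest} → Consec a b rest → Consec a b (c ∷ rest)

EdgeOn : {n : ℕ} → Fin n → Fin n → List (Fin n) → Set
EdgeOn a b p = Consec a b p ⊎ Consec b a p

-- the link with endpoints s,t covers the tree edge ab: ab lies on the
-- (unique, in a tree) path from s to t
Covers : {n : ℕ} → Graph n → Fin n → Fin n → Fin n → Fin n → Set
Covers E s t a b = ∃ λ p → IsPath E s t p × EdgeOn a b p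

CoversL : {n m : ℕ} → Graph n → (Fin m → Fin n × Fin n) → Fin m → Fin n → Fin n → Set
CoversL E ends i a b = Covers E (proj₁ (ends i)) (proj₂ (ends i)) a b

xSum : {m : ℕ} → (Fin m → ℚ) → {P : Fin m → Set} → ((i : Fin m) → Dec (P i)) → ℚ
xSum {m} x P? = foldr ℚ._+_ 0ℚ (map (λ i → if does (P? i) then x i else 0ℚ) (allFin m))

-- A problem instance (T, L) together with a decision procedure for covering
-- (covering is decidable since everything is finite; the sums below do not
-- depend on which decision procedure is used).
module LP {n m : ℕ} (E : Graph n) (ends : Fin m → Fin n × Fin n)
          (cov? : ∀ i a b → Dec (CoversL E ends i a b)) (x : Fin m → ℚ) where

  xδ : Fin n → Fin n → ℚ
  xδ a b = xSum x (λ i → cov? i a b)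

  xδ3 : Fin n → Fin n → Fin n → Fin n → ℚ
  xδ3 a b c d = xSum x (λ i → cov? i a b ⊎-dec (cov? i a c ⊎-dec cov? i a d))

  xδ2∖ : Fin n → Fin n → Fin n → Fin n → ℚ
  xδ2∖ a b c e = xSum x (λ i → (cov? i a b ⊎-dec cov? i a c) ×-dec ¬? (cov? i a e))

  record Feasible : Set where
    field
      nonneg   : ∀ i → 0ℚ ℚ.≤ x i
      edgeCov  : ∀ a b → T (E a b) → ℚ.1ℚ ℚ.≤ xδ a b
      nodeCov  : ∀ u w₁ w₂ w₃ → degree E u ≡ 3 →
                 T (E u w₁) → T (E u w₂) → T (E u w₃) →
                 ¬ w₁ ≡ w₂ → ¬ w₁ ≡ w₃ → ¬ w₂ ≡ w₃ →
                 (Data.Integer.+ 2 ℚ./ 1) ℚ.≤ xδ3 u w₁ w₂ w₃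

{-# OPTIONS --safe #-}
module Submission where

-- The links through u are partitioned into those covering uv and those covering
-- uw₁ or uw₂ but not uv, so the degree constraint at u says
-- x(δ(uv)) + x((δ(uw₁) ∪ δ(uw₂)) ∖ δ(uv)) ≥ 2; with x(δ(uv)) < 4/3 the second
-- term must be at least 2/3. Nothing else about T, L or x is needed.

open import Defs
open import Data.Nat using (ℕ)
open import Data.Fin using (Fin)
open import Data.Bool using (Bool; true; false; T; if_then_else_; _∨_; _∧_; not)
open import Data.List using (List; []; _∷_; map; foldr; allFin)
open import Data.List.Properties using (map-cong)
open import Data.Product using (_×_; _,_; proj₁; proj₂)
open import Data.Sum using (_⊎_)
open import Relation.Nullary using (¬_; Dec; does)
open import Relation.Nullary.Decidable using (_⊎-dec_; _×-dec_; ¬?)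
open import Relation.Binary.PropositionalEquality using (_≡_; refl; sym; cong; module ≡-Reasoning)
open import Data.Rational using (ℚ; 0ℚ; _+_; _≤_; _<_; _/_)
open import Data.Rational.Properties as ℚ using ()
open import Data.Integer using (+_)
open import Algebra.Bundles using (CommutativeMonoid)
open import Algebra.Properties.CommutativeSemigroup
  (CommutativeMonoid.commutativeSemigroup ℚ.+-0-commutativeMonoid) using (interchange)

sumℚ : List ℚ → ℚ
sumℚ = foldr _+_ 0ℚ

sumℚ-map-+ : {A : Set} (f g : A → ℚ) (xs : List A) →
  sumℚ (map (λ i → f i + g i) xs) ≡ sumℚ (map f xs) + sumℚ (map g xs)
sumℚ-map-+ f g [] = refl
sumℚ-map-+ f g (i ∷ xs) = begin
  (f i + g i) + sumℚ (map (λ j → f j + g j) xs)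
    ≡⟨ cong (_+_ (f i + g i)) (sumℚ-map-+ f g xs) ⟩
  (f i + g i) + (sumℚ (map f xs) + sumℚ (map g xs))
    ≡⟨ interchange (f i) (g i) _ _ ⟩
  (f i + sumℚ (map f xs)) + (g i + sumℚ (map g xs))  ∎
  where open ≡-Reasoning

if-∨-split : (y : ℚ) (a b : Bool) →
  (if a ∨ b then y else 0ℚ) ≡ (if a then y else 0ℚ) + (if b ∧ not a then y else 0ℚ)
if-∨-split y true  true  = sym (ℚ.+-identityʳ y)
if-∨-split y true  false = sym (ℚ.+-identityʳ y)
if-∨-split y false true  = sym (ℚ.+-identityˡ y)
if-∨-split y false false = refl

xSum-⊎-dec : {m : ℕ} (x : Fin m → ℚ) {P Q : Fin m → Set}
  (P? : ∀ i → Dec (P i)) (Q? : ∀ i → Dec (Q i)) →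
  xSum x (λ i → P? i ⊎-dec Q? i) ≡ xSum x P? + xSum x (λ i → Q? i ×-dec ¬? (P? i))
xSum-⊎-dec {m} x P? Q? = begin
  sumℚ (map (λ i → if does (P? i) ∨ does (Q? i) then x i else 0ℚ) (allFin m))
    ≡⟨ cong sumℚ (map-cong (λ i → if-∨-split (x i) (does (P? i)) (does (Q? i))) (allFin m)) ⟩
  sumℚ (map (λ i → (if does (P? i) then x i else 0ℚ)
                 + (if does (Q? i) ∧ not (does (P? i)) then x i else 0ℚ)) (allFin m))
    ≡⟨ sumℚ-map-+ _ _ (allFin m) ⟩
  xSum x P? + xSum x (λ i → Q? i ×-dec ¬? (P? i))  ∎
  where open ≡-Reasoning

≤-of-+-≤-+-< : {a b d e : ℚ} → d + e ≤ a + b → a < d → e ≤ b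
≤-of-+-≤-+-< d+e≤a+b a<d = ℚ.≮⇒≥ λ b<e →
  ℚ.<-irrefl refl (ℚ.<-≤-trans (ℚ.+-mono-< a<d b<e) d+e≤a+b)

mainTheorem5 : {n m : ℕ} (E : Graph n) → IsTree E → IsBinary E →
    (ends : Fin m → Fin n × Fin n) →
    (∀ i → IsLeaf E (proj₁ (ends i)) × IsLeaf E (proj₂ (ends i)) × ¬ proj₁ (ends i) ≡ proj₂ (ends i)) →
    (∀ i j → ends i ≡ ends j ⊎ ends i ≡ (proj₂ (ends j) , proj₁ (ends j)) → i ≡ j) →
    (cov? : ∀ i a b → Dec (CoversL E ends i a b)) →
    (x : Fin m → Data.Rational.ℚ) → LP.Feasible E ends cov? x →
    (u v w₁ w₂ : Fin n) → degree E u ≡ 3 →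
    T (E u v) → T (E u w₁) → T (E u w₂) →
    ¬ v ≡ w₁ → ¬ v ≡ w₂ → ¬ w₁ ≡ w₂ →
    LP.xδ E ends cov? x u v < (+ 4 / 3) →
    (+ 2 / 3) ≤ LP.xδ2∖ E ends cov? x u w₁ w₂ v
mainTheorem5 E _ _ ends _ _ cov? x feasible u v w₁ w₂ deg-u uv uw₁ uw₂ v≢w₁ v≢w₂ w₁≢w₂ deficient =
  ≤-of-+-≤-+-< node-bound deficient
  where
  open LP E ends cov? x

  node-split : xδ3 u v w₁ w₂ ≡ xδ u v + xδ2∖ u w₁ w₂ v
  node-split = xSum-⊎-dec x (λ i → cov? i u v) (λ i → cov? i u w₁ ⊎-dec cov? i u w₂)

  -- 4/3 + 2/3 normalises to the 2/1 of the degree constraint.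
  node-bound : (+ 4 / 3) + (+ 2 / 3) ≤ xδ u v + xδ2∖ u w₁ w₂ v
  node-bound = ℚ.≤-trans
    (Feasible.nodeCov feasible u v w₁ w₂ deg-u uv uw₁ uw₂ v≢w₁ v≢w₂ w₁≢w₂)
    (ℚ.≤-reflexive node-split)
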